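{- Let $G$ be a finite simple graph with an edge $e=vw$. If $e$ is contained in no even cycle of $G$, then $p(G;z)=p(G\setminus e;z)+z\,p(G-\{v,w\};z)$. Consequently, if $v$ is a vertex of $G$ contained in no even cycle and with neighbors $w_1,\dots,w_r$, then $p(G;z)=p(G-v;z)+z\sum_{i=1}^r p(G-\{v,w_i\};z)$.
   Context: A perfectly matchable set of a graph $G$ is a subset $S\subseteq V(G)$ such that the induced subgraph $G[S]$ has a perfect matching; the empty set counts as one. $p(G;z)=\sum_{k\ge0}p_{2k}z^k$, where $p_{2k}$ is the number of perfectly matchable sets of size $2k$. $G\setminus e$ denotes edge deletion; $G-v$, $G-\{v,w\}$ denote vertex deletion. -}

module Defs where

open import Data.Nat using (ℕ; zero; suc; _+_; _*_; _≤_)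
open import Data.Nat.Divisibility using (_∣_)
open import Data.Bool using (Bool; true; false; _∧_; _∨_; not; if_then_else_)
open import Data.Bool.Properties using (∧-comm; ∨-comm)
open import Data.Fin using (Fin; zero; suc)
open import Data.Fin.Properties using (any?; all?) renaming (_≟_ to _≟ᶠ_)
open import Data.Fin.Subset using (Subset; _∈_; _⊆_; _-_; ∣_∣; inside; outside)
open import Data.Fin.Subset.Properties using (_∈?_; _⊆?_)
open import Data.Vec using (Vec; []; _∷_; lookup)
open import Data.List using (List; []; _∷_; [_]; _++_; map; filter; length; allFin)
open import Data.Nat.ListAction using (sum)
open import Data.Product using (Σ; ∃; _×_; _,_)
open import Data.Sum using (_⊎_)
open import Data.Empty using (⊥)
open import Relation.Nullary using (Dec; yes; no; ¬_; ¬?)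
open import Relation.Nullary.Decidable using (⌊_⌋; map′; _×-dec_; _→-dec_)
open import Relation.Binary.PropositionalEquality using (_≡_; refl; cong; cong₂; trans)
import Data.Nat as ℕ

-- The vertex set is a subset V of Fin n (so that vertex deletion yields
-- again a graph of the same kind); adjacency is a symmetric,
-- irreflexive Boolean relation; the edges are the adjacent pairs of
-- vertices lying in V.

record Graph (n : ℕ) : Set where
  field
    V          : Subset n
    adj        : Fin n → Fin n → Bool
    adj-sym    : ∀ i j → adj i j ≡ adj j i
    adj-irrefl : ∀ i → adj i i ≡ false

open Graph public

Edge : ∀ {n} → Graph n → Fin n → Fin n → Set
Edge G i j = i ∈ V G × j ∈ V G × adj G i j ≡ true

edge? : ∀ {n} (G : Graph n) i j → Dec (Edge G i j)
edge? G i j = (i ∈? V G) ×-dec (j ∈? V G) ×-dec (adj G i j Data.Bool.≟ true)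

delVertex : ∀ {n} → Graph n → Fin n → Graph n
delVertex G v = record
  { V = V G - v ; adj = adj G ; adj-sym = adj-sym G ; adj-irrefl = adj-irrefl G }

delVertices2 : ∀ {n} → Graph n → Fin n → Fin n → Graph n
delVertices2 G v w = delVertex (delVertex G v) w

samePair : ∀ {n} → Fin n → Fin n → Fin n → Fin n → Bool
samePair v w i j = (⌊ i ≟ᶠ v ⌋ ∧ ⌊ j ≟ᶠ w ⌋) ∨ (⌊ i ≟ᶠ w ⌋ ∧ ⌊ j ≟ᶠ v ⌋)

samePair-sym : ∀ {n} (v w i j : Fin n) → samePair v w i j ≡ samePair v w j i
samePair-sym v w i j =
  trans (cong₂ _∨_ (∧-comm ⌊ i ≟ᶠ v ⌋ ⌊ j ≟ᶠ w ⌋) (∧-comm ⌊ i ≟ᶠ w ⌋ ⌊ j ≟ᶠ v ⌋))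
        (∨-comm (⌊ j ≟ᶠ w ⌋ ∧ ⌊ i ≟ᶠ v ⌋) (⌊ j ≟ᶠ v ⌋ ∧ ⌊ i ≟ᶠ w ⌋))

delEdge : ∀ {n} → Graph n → Fin n → Fin n → Graph n
delEdge G v w = record
  { V = V G
  ; adj = λ i j → adj G i j ∧ not (samePair v w i j)
  ; adj-sym = λ i j → cong₂ _∧_ (adj-sym G i j) (cong not (samePair-sym v w i j))
  ; adj-irrefl = λ i → cong (_∧ not (samePair v w i i)) (adj-irrefl G i)
  }

-- cyclic successor on Fin L
next : ∀ {L} → Fin L → Fin L
next {suc zero} zero = zero
next {suc (suc m)} zero = suc zero
next {suc (suc m)} (suc i) = step (next {suc m} i)
  where
  step : Fin (suc m) → Fin (suc (suc m))
  step zero = zero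
  step (suc j) = suc (suc j)

record Cycle {n} (G : Graph n) (L : ℕ) : Set where
  field
    length≥3 : 3 ≤ L
    vtx      : Fin L → Fin n
    distinct : ∀ a b → vtx a ≡ vtx b → a ≡ b
    edges    : ∀ a → Edge G (vtx a) (vtx (next a))

open Cycle public

EdgeOnEvenCycle : ∀ {n} → Graph n → Fin n → Fin n → Set
EdgeOnEvenCycle G v w =
  Σ ℕ λ L → 2 ∣ L × Σ (Cycle G L) λ c → ∃ λ a →
    (vtx c a ≡ v × vtx c (next a) ≡ w) ⊎ (vtx c a ≡ w × vtx c (next a) ≡ v)

VertexOnEvenCycle : ∀ {n} → Graph n → Fin n → Set
VertexOnEvenCycle G v =
  Σ ℕ λ L → 2 ∣ L × Σ (Cycle G L) λ c → ∃ λ a → vtx c a ≡ v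

-- A perfect matching of G[S] is encoded by its partner map
-- m : Fin n → Fin n (given as a vector): each i ∈ S is matched to
-- m i ∈ S, with m i ≠ i, m (m i) = i and i (m i) an edge of G.
-- (The set of edges {i, m i}, i ∈ S, is then a set of pairwise
-- disjoint edges of G[S] covering S, and conversely.)

IsPerfectMatching : ∀ {n} → Graph n → Subset n → Vec (Fin n) n → Set
IsPerfectMatching G S m = ∀ i → i ∈ S →
  lookup m i ∈ S × ¬ (lookup m i ≡ i) × lookup m (lookup m i) ≡ i × Edge G i (lookup m i)

HasPerfectMatching : ∀ {n} → Graph n → Subset n → Set
HasPerfectMatching {n} G S = Σ (Vec (Fin n) n) (IsPerfectMatching G S)

PerfectlyMatchable : ∀ {n} → Graph n → Subset n → Set
PerfectlyMatchable G S = S ⊆ V G × HasPerfectMatching G S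

∃Vec? : ∀ {n} k (P : Vec (Fin n) k → Set) → (∀ v → Dec (P v)) → Dec (∃ P)
∃Vec? zero P d = map′ (λ p → [] , p) (λ { ([] , p) → p }) (d [])
∃Vec? (suc k) P d =
  map′ (λ { (a , v , p) → a ∷ v , p }) (λ { (a ∷ v , p) → a , v , p })
       (any? λ a → ∃Vec? k (λ v → P (a ∷ v)) (λ v → d (a ∷ v)))

isPM? : ∀ {n} (G : Graph n) S m → Dec (IsPerfectMatching G S m)
isPM? G S m = all? λ i → (i ∈? S) →-dec
  ((lookup m i ∈? S) ×-dec ¬? (lookup m i ≟ᶠ i) ×-dec
   (lookup m (lookup m i) ≟ᶠ i) ×-dec edge? G i (lookup m i))

perfectlyMatchable? : ∀ {n} (G : Graph n) S → Dec (PerfectlyMatchable G S)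
perfectlyMatchable? {n} G S = (S ⊆? V G) ×-dec ∃Vec? n (IsPerfectMatching G S) (isPM? G S)

allSubsets : ∀ n → List (Subset n)
allSubsets zero = [ [] ]
allSubsets (suc n) = map (inside ∷_) (allSubsets n) ++ map (outside ∷_) (allSubsets n)

-- Polynomials in z with ℕ coefficients, as coefficient sequences.

Poly : Set
Poly = ℕ → ℕ

_⊕_ : Poly → Poly → Poly
(p ⊕ q) k = p k + q k

z·_ : Poly → Poly
(z· p) zero = 0
(z· p) (suc k) = p k

∑ : ∀ {n} → (Fin n → Poly) → Poly
∑ {n} f k = sum (map (λ i → f i k) (allFin n))

-- p(G; z) : coefficient of z^k is p_{2k}, the number of perfectly
-- matchable sets of G of size 2k.
pm : ∀ {n} → Graph n → Poly
pm {n} G k = length (filter (λ S → perfectlyMatchable? G S ×-dec (∣ S ∣ ℕ.≟ 2 * k)) (allSubsets n))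

neighbourSum : ∀ {n} → Graph n → Fin n → Poly
neighbourSum G v = ∑ λ w → if ⌊ edge? G v w ⌋ then pm (delVertices2 G v w) else (λ _ → 0)

{-# OPTIONS --safe #-}
-- Sort the perfectly matchable sets S of G by whether G[S] has a perfect matching avoiding e = vw.
-- Those that do are exactly the perfectly matchable sets of G \ e; in those that do not, every
-- perfect matching pairs v with w, so S ∖ {v, w} is a perfectly matchable set of G − {v, w}, and
-- S ↦ S ∖ {v, w} is a bijection onto such sets with two fewer elements, whence the factor z.
-- No set falls into both classes: if G[S] had perfect matchings M₁ ∋ vw and M₂ ∌ vw, then walking
-- from v alternately along M₁ and M₂ closes up into an even cycle through vw. In the same way, if v
-- lies on no even cycle, all perfect matchings of G[S] match v to the same neighbour w, and S is
-- counted in exactly one term of the sum over the neighbours of v.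
module Submission where

open import Defs
open import Data.Bool using (Bool; true; false; not; if_then_else_)
open import Data.Bool.Properties using (∧-conicalˡ; ∧-conicalʳ)
open import Data.Empty using (⊥-elim)
open import Data.Fin using (Fin; zero; suc; toℕ)
open import Data.Fin.Properties using (0≢1+n; toℕ-injective; toℕ<n; pigeonhole)
  renaming (_≟_ to _≟ᶠ_; suc-injective to Fin-suc-injective)
open import Data.Fin.Subset using (Subset; _∈_; _∉_; _-_; _─_; ⁅_⁆; ⊥; ∣_∣; inside; outside)
open import Data.Fin.Subset.Properties using (_∈?_; p─⊥≡p; p─q⊆p; x∈p∧x≢y⇒x∈p-y)
open import Data.List using (List; []; _∷_; _++_; map; filter; length; allFin)
import Data.List as List
open import Data.List.Properties using (map-cong; map-++; map-∘)
open import Data.Nat using (ℕ; zero; suc; _+_; _*_; _<_; _≤_; s≤s; s≤s⁻¹; z≤n; parity)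
open import Data.Nat.Divisibility using (_∣_; _∣0; ∣-refl; ∣m∣n⇒∣m+n)
open import Data.Nat.ListAction using (sum)
open import Data.Nat.ListAction.Properties using (sum-++)
open import Data.Nat.Properties
  using (_≟_; *-suc; suc-injective; +-comm; n<1+n; m≤n⇒m<n∨m≡n; <-cmp; anyUpTo?;
         +-0-commutativeMonoid; +-commutativeSemigroup)
open import Algebra.Properties.CommutativeSemigroup +-commutativeSemigroup
  using () renaming (interchange to +-interchange)
open import Algebra.Properties.CommutativeMonoid.Sum +-0-commutativeMonoid
  using (sum-syntax; sum-cong-≗; ∑-distrib-+; sum-replicate-zero)
open import Data.Parity.Base using (Parity; 0ℙ; 1ℙ; _⁻¹)
open import Data.Parity.Properties using (⁻¹-selfInverse; suc-homo-⁻¹) renaming (_≟_ to _≟ℙ_)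
open import Data.Product using (Σ; ∃; _×_; _,_; proj₁; proj₂; uncurry)
open import Data.Sum using (_⊎_; inj₁; inj₂)
open import Data.Vec using (_∷_; here; there; tabulate; lookup)
open import Data.Vec.Properties using (lookup∘tabulate)
open import Function using (_∘_)
open import Relation.Binary using (tri<; tri≈; tri>)
open import Relation.Binary.PropositionalEquality
  using (_≡_; _≢_; refl; sym; trans; cong; cong₂; subst; module ≡-Reasoning)
open import Relation.Nullary using (Dec; yes; no; ¬_; does)
open import Relation.Nullary.Decidable using (⌊_⌋; _×-dec_; map′; decidable-stable; dec-true; dec-false)
open import Relation.Unary using (Pred; Decidable)

does-≡ : {P Q : Set} (P? : Dec P) (Q? : Dec Q) → (P → Q) → (Q → P) → does P? ≡ does Q?
does-≡ (yes _) (yes _) _  _    = refl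
does-≡ (yes p) (no ¬q) to _    = ⊥-elim (¬q (to p))
does-≡ (no ¬p) (yes q) _  from = ⊥-elim (¬p (from q))
does-≡ (no _)  (no _)  _  _    = refl

𝟙 : {P : Set} → Dec P → ℕ
𝟙 P? = if does P? then 1 else 0

𝟙-yes : {P : Set} (P? : Dec P) → P → 𝟙 P? ≡ 1
𝟙-yes P? p = cong (if_then 1 else 0) (dec-true P? p)

𝟙-no : {P : Set} (P? : Dec P) → ¬ P → 𝟙 P? ≡ 0
𝟙-no P? ¬p = cong (if_then 1 else 0) (dec-false P? ¬p)

𝟙-× : {A B : Set} (A? : Dec A) (B? : Dec B) → 𝟙 (A? ×-dec B?) ≡ (if does A? then 𝟙 B? else 0)
𝟙-× (yes _) _ = refl
𝟙-× (no _)  _ = refl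

𝟙-cong : {P Q : Set} (P? : Dec P) (Q? : Dec Q) → (P → Q) → (Q → P) → 𝟙 P? ≡ 𝟙 Q?
𝟙-cong P? Q? to from = cong (if_then 1 else 0) (does-≡ P? Q? to from)

𝟙-split : {A B : Set} (A? : Dec A) (B? : Dec B) {m : ℕ} →
  (B → A) → (B → m ≡ 0) → (A → ¬ B → m ≡ 1) → (¬ A → m ≡ 0) → 𝟙 A? ≡ 𝟙 B? + m
𝟙-split (yes _) (yes b) _   B⇒0 _     _    = cong suc (sym (B⇒0 b))
𝟙-split (yes a) (no ¬b) _   _   A¬B⇒1 _    = sym (A¬B⇒1 a ¬b)
𝟙-split (no ¬a) (yes b) B⇒A _   _     _    = ⊥-elim (¬a (B⇒A b))
𝟙-split (no ¬a) (no _)  _   _   _     ¬A⇒0 = sym (¬A⇒0 ¬a)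

length-filter≡sum-𝟙 : {A : Set} {P : Pred A _} (P? : Decidable P) (xs : List A) →
  length (filter P? xs) ≡ sum (map (𝟙 ∘ P?) xs)
length-filter≡sum-𝟙 P? [] = refl
length-filter≡sum-𝟙 P? (x ∷ xs) with does (P? x)
... | true = cong suc (length-filter≡sum-𝟙 P? xs)
... | false = length-filter≡sum-𝟙 P? xs

sum-map-zero : {A : Set} {f : A → ℕ} → (∀ x → f x ≡ 0) → ∀ xs → sum (map f xs) ≡ 0
sum-map-zero f≗0 [] = refl
sum-map-zero f≗0 (x ∷ xs) = cong₂ _+_ (f≗0 x) (sum-map-zero f≗0 xs)

sum-map-+ : {A : Set} (f g : A → ℕ) (xs : List A) →
  sum (map (λ x → f x + g x) xs) ≡ sum (map f xs) + sum (map g xs)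
sum-map-+ f g [] = refl
sum-map-+ f g (x ∷ xs) =
  trans (cong (f x + g x +_) (sum-map-+ f g xs)) (+-interchange (f x) (g x) _ _)

sum-map-∑-comm : ∀ {A : Set} {n} (g : Fin n → A → ℕ) (xs : List A) →
  sum (map (λ x → ∑[ i < n ] g i x) xs) ≡ ∑[ i < n ] sum (map (g i) xs)
sum-map-∑-comm {n = n} g [] = sym (sum-replicate-zero n)
sum-map-∑-comm {n = n} g (x ∷ xs) = trans
  (cong (∑[ i < n ] g i x +_) (sum-map-∑-comm g xs))
  (sym (∑-distrib-+ (λ i → g i x) (λ i → sum (map (g i) xs))))

sum-allFin : ∀ {n} (f : Fin n → ℕ) → sum (map f (allFin n)) ≡ ∑[ i < n ] f i
sum-allFin f = go f (λ i → i)
  where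
  go : ∀ {n m} (f : Fin n → ℕ) (g : Fin m → Fin n) → sum (map f (List.tabulate g)) ≡ ∑[ i < m ] f (g i)
  go {m = zero} f g = refl
  go {m = suc m} f g = cong (f (g zero) +_) (go f (g ∘ suc))

∑-zero : ∀ {n} {f : Fin n → ℕ} → (∀ i → f i ≡ 0) → ∑[ i < n ] f i ≡ 0
∑-zero {n} f≗0 = trans (sum-cong-≗ f≗0) (sum-replicate-zero n)

∑-𝟙-unique : ∀ {n} {R : Fin n → Set} (R? : Decidable R) {i₀} → R i₀ → (∀ {i} → R i → i ≡ i₀) →
  ∑[ i < n ] 𝟙 (R? i) ≡ 1
∑-𝟙-unique {suc n} R? {zero} Ri₀ unique =
  cong₂ _+_ (𝟙-yes (R? zero) Ri₀) (∑-zero λ i → 𝟙-no (R? (suc i)) (0≢1+n ∘ sym ∘ unique))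
∑-𝟙-unique {suc n} R? {suc i₀} Ri₀ unique =
  cong₂ _+_ (𝟙-no (R? zero) (0≢1+n ∘ unique)) (∑-𝟙-unique (R? ∘ suc) Ri₀ (Fin-suc-injective ∘ unique))

x∈p-y⇒x∈p : ∀ {n} {x y : Fin n} {p : Subset n} → x ∈ p - y → x ∈ p
x∈p-y⇒x∈p {y = y} {p} = p─q⊆p p ⁅ y ⁆

x∈p-y⇒x≢y : ∀ {n} {x y : Fin n} {p : Subset n} → x ∈ p - y → x ≢ y
x∈p-y⇒x≢y {x = zero} {p = _ ∷ _} () refl
x∈p-y⇒x≢y {x = suc x} {p = _ ∷ p} (there x∈p-y) refl = x∈p-y⇒x≢y {p = p} x∈p-y refl

x∈p⇒∣p∣≡1+∣p-x∣ : ∀ {n} {x : Fin n} {p : Subset n} → x ∈ p → ∣ p ∣ ≡ suc ∣ p - x ∣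
x∈p⇒∣p∣≡1+∣p-x∣ {x = zero} {inside ∷ p} here = cong suc (cong ∣_∣ (sym (p─⊥≡p p)))
x∈p⇒∣p∣≡1+∣p-x∣ {x = suc x} {inside ∷ p} (there x∈p) = cong suc (x∈p⇒∣p∣≡1+∣p-x∣ x∈p)
x∈p⇒∣p∣≡1+∣p-x∣ {x = suc x} {outside ∷ p} (there x∈p) = x∈p⇒∣p∣≡1+∣p-x∣ x∈p

x∈p-v-w⁺ : ∀ {n} {x v w : Fin n} {p : Subset n} → x ∈ p → x ≢ v → x ≢ w → x ∈ p - v - w
x∈p-v-w⁺ x∈p x≢v x≢w = x∈p∧x≢y⇒x∈p-y (x∈p∧x≢y⇒x∈p-y x∈p x≢v) x≢w

∣p∣≡2+∣p-v-w∣ : ∀ {n} {v w : Fin n} {p : Subset n} → v ∈ p → w ∈ p → v ≢ w →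
  ∣ p ∣ ≡ suc (suc ∣ p - v - w ∣)
∣p∣≡2+∣p-v-w∣ v∈p w∈p v≢w =
  trans (x∈p⇒∣p∣≡1+∣p-x∣ v∈p)
        (cong suc (x∈p⇒∣p∣≡1+∣p-x∣ (x∈p∧x≢y⇒x∈p-y w∈p (v≢w ∘ sym))))

∈?-remove : ∀ {n} {x y : Fin n} (p : Subset n) → x ≢ y → does (x ∈? p - y) ≡ does (x ∈? p)
∈?-remove p x≢y = does-≡ (_ ∈? p - _) (_ ∈? p) x∈p-y⇒x∈p (λ x∈p → x∈p∧x≢y⇒x∈p-y x∈p x≢y)

sumSubsets : ∀ {n} → (Subset n → ℕ) → ℕ
sumSubsets {n} f = sum (map f (allSubsets n))

sumSubsets-cong : ∀ {n} {f g : Subset n → ℕ} → (∀ S → f S ≡ g S) → sumSubsets f ≡ sumSubsets g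
sumSubsets-cong {n} f≗g = cong sum (map-cong f≗g (allSubsets n))

sumSubsets-zero : ∀ {n} {f : Subset n → ℕ} → (∀ S → f S ≡ 0) → sumSubsets f ≡ 0
sumSubsets-zero {n} f≗0 = sum-map-zero f≗0 (allSubsets n)

sumSubsets-+ : ∀ {n} (f g : Subset n → ℕ) → sumSubsets (λ S → f S + g S) ≡ sumSubsets f + sumSubsets g
sumSubsets-+ {n} f g = sum-map-+ f g (allSubsets n)

sumSubsets-∷ : ∀ {n} (f : Subset (suc n) → ℕ) →
  sumSubsets f ≡ sumSubsets (f ∘ (inside ∷_)) + sumSubsets (f ∘ (outside ∷_))
sumSubsets-∷ {n} f = begin
  sum (map f (map (inside ∷_) A ++ map (outside ∷_) A))
    ≡⟨ cong sum (map-++ f (map (inside ∷_) A) _) ⟩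
  sum (map f (map (inside ∷_) A) ++ map f (map (outside ∷_) A))
    ≡⟨ sum-++ (map f (map (inside ∷_) A)) _ ⟩
  sum (map f (map (inside ∷_) A)) + sum (map f (map (outside ∷_) A))
    ≡⟨ sym (cong₂ _+_ (cong sum (map-∘ A)) (cong sum (map-∘ A))) ⟩
  sum (map (f ∘ (inside ∷_)) A) + sum (map (f ∘ (outside ∷_)) A) ∎
  where
  open ≡-Reasoning
  A : List (Subset n)
  A = allSubsets n

sumSubsets-remove : ∀ {n} (v : Fin n) (f : Subset n → ℕ) →
  sumSubsets (λ S → if does (v ∈? S) then f (S - v) else 0) ≡
  sumSubsets (λ S → if does (v ∈? S) then 0 else f S)
sumSubsets-remove {suc n} zero f = begin
  sumSubsets F                                          ≡⟨ sumSubsets-∷ F ⟩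
  sumSubsets (λ s → f (outside ∷ (s ─ ⊥))) + sumSubsets {n} (λ _ → 0)
    ≡⟨ cong₂ _+_ (sumSubsets-cong (λ s → cong (f ∘ (outside ∷_)) (p─⊥≡p s)))
                 (sumSubsets-zero {n} λ _ → refl) ⟩
  sumSubsets (f ∘ (outside ∷_)) + 0
    ≡⟨ +-comm _ 0 ⟩
  0 + sumSubsets (f ∘ (outside ∷_))
    ≡⟨ cong (_+ sumSubsets (f ∘ (outside ∷_))) (sumSubsets-zero {n} λ _ → refl) ⟨
  sumSubsets {n} (λ _ → 0) + sumSubsets (f ∘ (outside ∷_)) ≡⟨ sumSubsets-∷ H ⟨
  sumSubsets H                                          ∎
  where
  open ≡-Reasoning
  F H : Subset (suc n) → ℕ
  F S = if does (zero ∈? S) then f (S - zero) else 0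
  H S = if does (zero ∈? S) then 0 else f S
sumSubsets-remove {suc n} (suc v) f = begin
  sumSubsets F                                          ≡⟨ sumSubsets-∷ F ⟩
  sumSubsets (F ∘ (inside ∷_)) + sumSubsets (F ∘ (outside ∷_))
    ≡⟨ cong₂ _+_ (sumSubsets-remove v (f ∘ (inside ∷_))) (sumSubsets-remove v (f ∘ (outside ∷_))) ⟩
  sumSubsets (H ∘ (inside ∷_)) + sumSubsets (H ∘ (outside ∷_)) ≡⟨ sumSubsets-∷ H ⟨
  sumSubsets H                                          ∎
  where
  open ≡-Reasoning
  F H : Subset (suc n) → ℕ
  F S = if does (suc v ∈? S) then f (S - suc v) else 0
  H S = if does (suc v ∈? S) then 0 else f S

if-guards-comm : ∀ (a b : Bool) {x : ℕ} →
  (if a then 0 else (if b then x else 0)) ≡ (if b then (if a then 0 else x) else 0)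
if-guards-comm true true = refl
if-guards-comm true false = refl
if-guards-comm false b = refl

sumSubsets-pair : ∀ {n} {v w : Fin n} → v ≢ w → {P : Pred (Subset n) _} (P? : Decidable P) →
  (∀ {T} → P T → v ∉ T × w ∉ T) →
  sumSubsets (λ S → 𝟙 (v ∈? S ×-dec w ∈? S ×-dec P? (S - v - w))) ≡ sumSubsets (𝟙 ∘ P?)
sumSubsets-pair {n} {v} {w} v≢w P? P⇒∉ = begin
  sumSubsets (λ S → 𝟙 (v ∈? S ×-dec w ∈? S ×-dec P? (S - v - w))) ≡⟨ sumSubsets-cong remove-v ⟩
  sumSubsets (λ S → if does (v ∈? S) then F (S - v) else 0)        ≡⟨ sumSubsets-remove v F ⟩
  sumSubsets (λ S → if does (v ∈? S) then 0 else F S)              ≡⟨ sumSubsets-cong remove-w ⟩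
  sumSubsets (λ S → if does (w ∈? S) then H (S - w) else 0)        ≡⟨ sumSubsets-remove w H ⟩
  sumSubsets (λ S → if does (w ∈? S) then 0 else H S)              ≡⟨ sumSubsets-cong drop-guards ⟩
  sumSubsets (𝟙 ∘ P?)                                              ∎
  where
  open ≡-Reasoning
  F H : Subset n → ℕ
  F X = if does (w ∈? X) then 𝟙 (P? (X - w)) else 0
  H X = if does (v ∈? X) then 0 else 𝟙 (P? X)

  remove-v : ∀ S → 𝟙 (v ∈? S ×-dec w ∈? S ×-dec P? (S - v - w)) ≡
    (if does (v ∈? S) then (if does (w ∈? S - v) then 𝟙 (P? (S - v - w)) else 0) else 0)
  remove-v S rewrite 𝟙-× (v ∈? S) (w ∈? S ×-dec P? (S - v - w)) | 𝟙-× (w ∈? S) (P? (S - v - w))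
                   | ∈?-remove {x = w} S (v≢w ∘ sym) = refl

  remove-w : ∀ S → (if does (v ∈? S) then 0 else (if does (w ∈? S) then 𝟙 (P? (S - w)) else 0)) ≡
    (if does (w ∈? S) then (if does (v ∈? S - w) then 0 else 𝟙 (P? (S - w))) else 0)
  remove-w S rewrite ∈?-remove {x = v} S v≢w = if-guards-comm (does (v ∈? S)) (does (w ∈? S))

  drop-guards : ∀ S → (if does (w ∈? S) then 0 else (if does (v ∈? S) then 0 else 𝟙 (P? S))) ≡ 𝟙 (P? S)
  drop-guards S with P? S
  ... | yes p rewrite dec-false (w ∈? S) (proj₂ (P⇒∉ p)) | dec-false (v ∈? S) (proj₁ (P⇒∉ p)) = refl
  ... | no _ with does (w ∈? S) | does (v ∈? S)
  ...   | true  | _     = refl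
  ...   | false | true  = refl
  ...   | false | false = refl

samePair-refl : ∀ {n} (v w : Fin n) → samePair v w v w ≡ true
samePair-refl v w with v ≟ᶠ v | w ≟ᶠ w
... | yes _  | yes _  = refl
... | no v≢v | _      = ⊥-elim (v≢v refl)
... | yes _  | no w≢w = ⊥-elim (w≢w refl)

samePair-false : ∀ {n} {v w i j : Fin n} → ¬ (i ≡ v × j ≡ w) → ¬ (i ≡ w × j ≡ v) →
  samePair v w i j ≡ false
samePair-false {v = v} {w} {i} {j} ¬vw ¬wv with i ≟ᶠ v | j ≟ᶠ w | i ≟ᶠ w | j ≟ᶠ v
... | yes i≡v | yes j≡w | _       | _       = ⊥-elim (¬vw (i≡v , j≡w))
... | _       | _       | yes i≡w | yes j≡v = ⊥-elim (¬wv (i≡w , j≡v))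
... | no _    | _       | no _    | _       = refl
... | no _    | _       | yes _   | no _    = refl
... | yes _   | no _    | no _    | _       = refl
... | yes _   | no _    | yes _   | no _    = refl

module _ {n} {G : Graph n} where

  edge⇒≢ : ∀ {i j} → Edge G i j → i ≢ j
  edge⇒≢ {i} (_ , _ , adj≡true) refl with () ← trans (sym adj≡true) (adj-irrefl G i)

  edge-sym : ∀ {i j} → Edge G i j → Edge G j i
  edge-sym {i} {j} (i∈V , j∈V , adj≡true) = j∈V , i∈V , trans (adj-sym G j i) adj≡true

  delVertex-edge⁻ : ∀ {x i j} → Edge (delVertex G x) i j → Edge G i j
  delVertex-edge⁻ (i∈V , j∈V , adj≡true) = x∈p-y⇒x∈p i∈V , x∈p-y⇒x∈p j∈V , adj≡true

  delVertex-edge⁺ : ∀ {x i j} → Edge G i j → i ≢ x → j ≢ x → Edge (delVertex G x) i j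
  delVertex-edge⁺ (i∈V , j∈V , adj≡true) i≢x j≢x =
    x∈p∧x≢y⇒x∈p-y i∈V i≢x , x∈p∧x≢y⇒x∈p-y j∈V j≢x , adj≡true

  delEdge-edge⁻ : ∀ {v w i j} → Edge (delEdge G v w) i j → Edge G i j
  delEdge-edge⁻ {i = i} {j} (i∈V , j∈V , adj≡true) = i∈V , j∈V , ∧-conicalˡ (adj G i j) _ adj≡true

  delEdge-edge⁺ : ∀ {v w i j} → Edge G i j → ¬ (i ≡ v × j ≡ w) → ¬ (i ≡ w × j ≡ v) →
    Edge (delEdge G v w) i j
  delEdge-edge⁺ (i∈V , j∈V , adj≡true) ¬vw ¬wv
    rewrite adj≡true | samePair-false ¬vw ¬wv = i∈V , j∈V , refl

  delEdge-removes : ∀ {v w} → ¬ Edge (delEdge G v w) v w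
  delEdge-removes {v} {w} (_ , _ , adj≡true)
    with () ← trans (sym (cong not (samePair-refl v w))) (∧-conicalʳ (adj G v w) _ adj≡true)

-- Perfect matchings as partner functions

record IsPerfectMatchingFn {n} (G : Graph n) (S : Subset n) (f : Fin n → Fin n) : Set where
  field
    partner∈      : ∀ {i} → i ∈ S → f i ∈ S
    partner≢      : ∀ {i} → i ∈ S → f i ≢ i
    partner-invol : ∀ {i} → i ∈ S → f (f i) ≡ i
    partner-edge  : ∀ {i} → i ∈ S → Edge G i (f i)

open IsPerfectMatchingFn public

module _ {n} {G : Graph n} {S : Subset n} where

  fromIsPerfectMatching : ∀ {m} → IsPerfectMatching G S m → IsPerfectMatchingFn G S (lookup m)
  fromIsPerfectMatching isPM = record
    { partner∈      = λ i∈S → proj₁ (isPM _ i∈S)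
    ; partner≢      = λ i∈S → proj₁ (proj₂ (isPM _ i∈S))
    ; partner-invol = λ i∈S → proj₁ (proj₂ (proj₂ (isPM _ i∈S)))
    ; partner-edge  = λ i∈S → proj₂ (proj₂ (proj₂ (isPM _ i∈S)))
    }

  toIsPerfectMatching : ∀ {m} → IsPerfectMatchingFn G S (lookup m) → IsPerfectMatching G S m
  toIsPerfectMatching m i i∈S = partner∈ m i∈S , partner≢ m i∈S , partner-invol m i∈S , partner-edge m i∈S

  isPerfectMatchingFn-cong : ∀ {f g} → (∀ i → f i ≡ g i) →
    IsPerfectMatchingFn G S f → IsPerfectMatchingFn G S g
  isPerfectMatchingFn-cong {f} {g} f≗g m = record
    { partner∈      = λ {i} i∈S → subst (_∈ S) (f≗g i) (partner∈ m i∈S)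
    ; partner≢      = λ {i} i∈S → partner≢ m i∈S ∘ trans (f≗g i)
    ; partner-invol = λ {i} i∈S → trans (sym (trans (cong f (f≗g i)) (f≗g (g i)))) (partner-invol m i∈S)
    ; partner-edge  = λ {i} i∈S → subst (Edge G i) (f≗g i) (partner-edge m i∈S)
    }

  perfectlyMatchable : ∀ {f} → IsPerfectMatchingFn G S f → PerfectlyMatchable G S
  perfectlyMatchable {f} m =
    (λ i∈S → proj₁ (partner-edge m i∈S)) ,
    tabulate f , toIsPerfectMatching {tabulate f} (isPerfectMatchingFn-cong (sym ∘ lookup∘tabulate f) m)

  isPerfectMatchingFn-mapEdges : ∀ {H : Graph n} {f} → (∀ {i} → i ∈ S → Edge G i (f i) → Edge H i (f i)) →
    IsPerfectMatchingFn G S f → IsPerfectMatchingFn H S f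
  isPerfectMatchingFn-mapEdges G⇒H m = record
    { partner∈ = partner∈ m ; partner≢ = partner≢ m ; partner-invol = partner-invol m
    ; partner-edge = λ i∈S → G⇒H i∈S (partner-edge m i∈S) }

  isPerfectMatchingFn-removePair : ∀ {f v w} → IsPerfectMatchingFn G S f → v ∈ S → f v ≡ w →
    IsPerfectMatchingFn (delVertices2 G v w) (S - v - w) f
  isPerfectMatchingFn-removePair {f} {v} {w} m v∈S fv≡w = record
    { partner∈      = λ i∈S-v-w → x∈p-v-w⁺ (partner∈ m (∈S i∈S-v-w)) (fi≢v i∈S-v-w) (fi≢w i∈S-v-w)
    ; partner≢      = partner≢ m ∘ ∈S
    ; partner-invol = partner-invol m ∘ ∈S
    ; partner-edge  = λ i∈S-v-w → let (i∈V , fi∈V , adj≡true) = partner-edge m (∈S i∈S-v-w) in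
        x∈p-v-w⁺ i∈V (≢v i∈S-v-w) (≢w i∈S-v-w) ,
        x∈p-v-w⁺ fi∈V (fi≢v i∈S-v-w) (fi≢w i∈S-v-w) ,
        adj≡true
    }
    where
    module _ {i} (i∈S-v-w : i ∈ S - v - w) where
      ∈S : i ∈ S
      ∈S = x∈p-y⇒x∈p (x∈p-y⇒x∈p i∈S-v-w)
      ≢v : i ≢ v
      ≢v = x∈p-y⇒x≢y (x∈p-y⇒x∈p i∈S-v-w)
      ≢w : i ≢ w
      ≢w = x∈p-y⇒x≢y i∈S-v-w
      fi≢v : f i ≢ v
      fi≢v fi≡v = ≢w (trans (sym (partner-invol m ∈S)) (trans (cong f fi≡v) fv≡w))
      fi≢w : f i ≢ w
      fi≢w fi≡w = ≢v (trans (sym (partner-invol m ∈S))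
                           (trans (cong f (trans fi≡w (sym fv≡w))) (partner-invol m v∈S)))

matchPair : ∀ {n} → Fin n → Fin n → (Fin n → Fin n) → Fin n → Fin n
matchPair v w f i with i ≟ᶠ v | i ≟ᶠ w
... | yes _ | _     = w
... | no _  | yes _ = v
... | no _  | no _  = f i

module _ {n} {v w : Fin n} (f : Fin n → Fin n) where

  matchPair-v : matchPair v w f v ≡ w
  matchPair-v with v ≟ᶠ v
  ... | yes _  = refl
  ... | no v≢v = ⊥-elim (v≢v refl)

  matchPair-w : v ≢ w → matchPair v w f w ≡ v
  matchPair-w v≢w with w ≟ᶠ v | w ≟ᶠ w
  ... | yes w≡v | _      = ⊥-elim (v≢w (sym w≡v))
  ... | no _    | yes _  = refl
  ... | no _    | no w≢w = ⊥-elim (w≢w refl)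

  matchPair-other : ∀ {i} → i ≢ v → i ≢ w → matchPair v w f i ≡ f i
  matchPair-other {i} i≢v i≢w with i ≟ᶠ v | i ≟ᶠ w
  ... | yes i≡v | _       = ⊥-elim (i≢v i≡v)
  ... | no _    | yes i≡w = ⊥-elim (i≢w i≡w)
  ... | no _    | no _    = refl

module _ {n} {G : Graph n} {S : Subset n} where

  isPerfectMatchingFn-addPair : ∀ {f v w} → Edge G v w → v ∈ S → w ∈ S →
    IsPerfectMatchingFn (delVertices2 G v w) (S - v - w) f → IsPerfectMatchingFn G S (matchPair v w f)
  isPerfectMatchingFn-addPair {f} {v} {w} vw v∈S w∈S m = record
    { partner∈      = proj₁ ∘ at
    ; partner≢      = proj₁ ∘ proj₂ ∘ at
    ; partner-invol = proj₁ ∘ proj₂ ∘ proj₂ ∘ at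
    ; partner-edge  = proj₂ ∘ proj₂ ∘ proj₂ ∘ at
    }
    where
    g : Fin n → Fin n
    g = matchPair v w f
    v≢w : v ≢ w
    v≢w = edge⇒≢ {G = G} vw
    at : ∀ {i} → i ∈ S → g i ∈ S × g i ≢ i × g (g i) ≡ i × Edge G i (g i)
    at {i} i∈S with i ≟ᶠ v | i ≟ᶠ w
    ... | yes refl | _    = w∈S , v≢w ∘ sym , matchPair-w f v≢w , vw
    ... | no _ | yes refl = v∈S , v≢w , matchPair-v {v = v} f , edge-sym {G = G} vw
    ... | no i≢v | no i≢w =
      x∈p-y⇒x∈p (x∈p-y⇒x∈p fi∈S-v-w) , partner≢ m i∈S-v-w ,
      trans (matchPair-other f (x∈p-y⇒x≢y (x∈p-y⇒x∈p fi∈S-v-w)) (x∈p-y⇒x≢y fi∈S-v-w))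
            (partner-invol m i∈S-v-w) ,
      delVertex-edge⁻ {G = G} (delVertex-edge⁻ {G = delVertex G v} (partner-edge m i∈S-v-w))
      where
      i∈S-v-w : i ∈ S - v - w
      i∈S-v-w = x∈p-v-w⁺ i∈S i≢v i≢w
      fi∈S-v-w : f i ∈ S - v - w
      fi∈S-v-w = partner∈ m i∈S-v-w

-- Alternating cycles

parity≡0ℙ⇒2∣ : ∀ m → parity m ≡ 0ℙ → 2 ∣ m
parity≡0ℙ⇒2∣ zero _ = 2 ∣0
parity≡0ℙ⇒2∣ (suc (suc m)) even = ∣m∣n⇒∣m+n ∣-refl (parity≡0ℙ⇒2∣ m even)

parity-suc : ∀ m → parity (suc m) ≡ parity m ⁻¹
parity-suc m = sym (⁻¹-selfInverse (suc-homo-⁻¹ m))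

p≢q⇒p⁻¹≡q : ∀ {p q : Parity} → p ≢ q → p ⁻¹ ≡ q
p≢q⇒p⁻¹≡q {0ℙ} {0ℙ} p≢q = ⊥-elim (p≢q refl)
p≢q⇒p⁻¹≡q {0ℙ} {1ℙ} _ = refl
p≢q⇒p⁻¹≡q {1ℙ} {0ℙ} _ = refl
p≢q⇒p⁻¹≡q {1ℙ} {1ℙ} p≢q = ⊥-elim (p≢q refl)

minimalWitness : {P : ℕ → Set} → Decidable P → ∀ {j} → P j → ∃ λ m → P m × (∀ {k} → k < m → ¬ P k)
minimalWitness {P} P? {j} Pj = below (suc j) (j , n<1+n j , Pj)
  where
  below : ∀ b → (∃ λ k → k < b × P k) → ∃ λ m → P m × (∀ {k} → k < m → ¬ P k)
  below (suc b) (k , k<1+b , Pk) with anyUpTo? P? b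
  ... | yes smaller = below b smaller
  ... | no ¬smaller with m≤n⇒m<n∨m≡n (s≤s⁻¹ k<1+b)
  ...   | inj₁ k<b  = ⊥-elim (¬smaller (k , k<b , Pk))
  ...   | inj₂ refl = k , Pk , λ k'<k Pk' → ¬smaller (_ , k'<k , Pk')

toℕ-next : ∀ {L} (a : Fin L) → toℕ (next a) ≡ suc (toℕ a) ⊎ (toℕ (next a) ≡ 0 × suc (toℕ a) ≡ L)
toℕ-next {suc zero} zero = inj₂ (refl , refl)
toℕ-next {suc (suc L)} zero = inj₁ refl
toℕ-next {suc (suc L)} (suc a) with next {suc L} a | toℕ-next {suc L} a
... | zero  | inj₂ (_ , last) = inj₂ (refl , cong suc last)
... | suc _ | inj₁ step       = inj₁ (cong suc step)

closedWalk⇒cycle : ∀ {n} {G : Graph n} (z : ℕ → Fin n) {L} → 3 ≤ L →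
  (∀ a → Edge G (z a) (z (suc a))) → z L ≡ z 0 → (∀ {a b} → a < b → b < L → z a ≢ z b) →
  Σ (Cycle G L) λ c → ∀ a → vtx c a ≡ z (toℕ a)
closedWalk⇒cycle {G = G} z {L} 3≤L edge closed injective = cycle , λ _ → refl
  where
  cycle : Cycle G L
  cycle = record
    { length≥3 = 3≤L
    ; vtx      = z ∘ toℕ
    ; distinct = λ a b za≡zb → toℕ-injective (injective′ (toℕ<n a) (toℕ<n b) za≡zb)
    ; edges    = edges′
    }
    where
    injective′ : ∀ {a b} → a < L → b < L → z a ≡ z b → a ≡ b
    injective′ {a} {b} a<L b<L za≡zb with <-cmp a b
    ... | tri< a<b _ _ = ⊥-elim (injective a<b b<L za≡zb)
    ... | tri≈ _ a≡b _ = a≡b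
    ... | tri> _ _ b<a = ⊥-elim (injective b<a a<L (sym za≡zb))
    edges′ : ∀ a → Edge G (z (toℕ a)) (z (toℕ (next a)))
    edges′ a with toℕ (next a) | toℕ-next a
    ... | _ | inj₁ refl = edge (toℕ a)
    ... | _ | inj₂ (refl , last) = subst (Edge G (z (toℕ a))) (trans (cong z last) closed) (edge (toℕ a))

EvenCycleAlong : ∀ {n} → Graph n → Fin n → Fin n → Set
EvenCycleAlong G v w = Σ ℕ λ L → 2 ∣ L × Σ (Cycle G L) λ c → ∃ λ a → vtx c a ≡ v × vtx c (next a) ≡ w

module AlternatingWalk {n} {G : Graph n} {S : Subset n} {f₁ f₂ : Fin n → Fin n}
  (m₁ : IsPerfectMatchingFn G S f₁) (m₂ : IsPerfectMatchingFn G S f₂) {v : Fin n} (v∈S : v ∈ S) where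

  matching : Parity → Fin n → Fin n
  matching 0ℙ = f₁
  matching 1ℙ = f₂

  isPerfectMatchingFn-matching : ∀ p → IsPerfectMatchingFn G S (matching p)
  isPerfectMatchingFn-matching 0ℙ = m₁
  isPerfectMatchingFn-matching 1ℙ = m₂

  walk : ℕ → Fin n
  walk zero = v
  walk (suc a) = matching (parity a) (walk a)

  walk∈S : ∀ a → walk a ∈ S
  walk∈S zero = v∈S
  walk∈S (suc a) = partner∈ (isPerfectMatchingFn-matching (parity a)) (walk∈S a)

  walk-back : ∀ a → matching (parity a) (walk (suc a)) ≡ walk a
  walk-back a = partner-invol (isPerfectMatchingFn-matching (parity a)) (walk∈S a)

  walk-back-at : ∀ a {p} → parity a ≡ p → matching p (walk (suc a)) ≡ walk a
  walk-back-at a refl = walk-back a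

  walk-edge : ∀ a → Edge G (walk a) (walk (suc a))
  walk-edge a = partner-edge (isPerfectMatchingFn-matching (parity a)) (walk∈S a)

  walk-step≢ : ∀ a → walk (suc a) ≢ walk a
  walk-step≢ a = partner≢ (isPerfectMatchingFn-matching (parity a)) (walk∈S a)

  Repeats : ℕ → Set
  Repeats j = ∃ λ i → i < j × walk i ≡ walk j

  repeats? : Decidable Repeats
  repeats? j = anyUpTo? (λ i → walk i ≟ᶠ walk j) j

  eventuallyRepeats : ∃ Repeats
  eventuallyRepeats with pigeonhole (n<1+n n) (walk ∘ toℕ)
  ... | i , j , i<j , walk-i≡j = toℕ j , toℕ i , i<j , walk-i≡j

  FirstRepeat : ℕ → Set
  FirstRepeat j = ∀ {k} → k < j → ¬ Repeats k

  -- Stepping back along the two matchings would produce an earlier repetition.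
  firstRepeat-fromStart : ∀ {i j} → i < j → walk i ≡ walk j → FirstRepeat j → i ≡ 0
  firstRepeat-fromStart {zero} _ _ _ = refl
  firstRepeat-fromStart {suc i} {suc j} (s≤s i<j) walk-i≡j first with parity i ≟ℙ parity j
  ... | yes same = ⊥-elim (first (n<1+n j) (i , i<j ,
        trans (sym (walk-back i)) (trans (cong₂ matching same walk-i≡j) (walk-back j))))
  ... | no differ with m≤n⇒m<n∨m≡n i<j
  ...   | inj₂ refl = ⊥-elim (walk-step≢ (suc i) (sym walk-i≡j))
  ...   | inj₁ 2+i≤j with m≤n⇒m<n∨m≡n 2+i≤j
  ...     | inj₂ refl = ⊥-elim (differ refl)
  ...     | inj₁ 2+i<j = ⊥-elim (first (n<1+n j) (suc (suc i) , 2+i<j ,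
            trans (cong₂ matching (trans (parity-suc i) (p≢q⇒p⁻¹≡q differ)) walk-i≡j) (walk-back j)))

  firstReturn-even : ∀ {j} → f₁ v ≢ f₂ v → 0 < j → walk 0 ≡ walk j → FirstRepeat j → 3 ≤ j × 2 ∣ j
  firstReturn-even {1} _ _ closed _ = ⊥-elim (walk-step≢ 0 (sym closed))
  firstReturn-even {2} disagree _ closed _ = ⊥-elim (disagree (sym (trans (cong f₂ closed) (walk-back 1))))
  firstReturn-even {suc (suc (suc j))} _ _ closed first with parity (suc (suc j)) ≟ℙ 0ℙ
  ... | no odd = s≤s (s≤s (s≤s z≤n)) ,
        parity≡0ℙ⇒2∣ (suc (suc (suc j))) (trans (parity-suc (suc (suc j))) (p≢q⇒p⁻¹≡q odd))
  ... | yes even = ⊥-elim (first (n<1+n (suc (suc j))) (1 , s≤s (s≤s z≤n) ,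
        trans (cong f₁ closed) (walk-back-at (suc (suc j)) even)))

  evenCycle : f₁ v ≢ f₂ v → EvenCycleAlong G v (f₁ v)
  evenCycle disagree
    with j , (i , i<j , walk-i≡j) , first ← minimalWitness repeats? (proj₂ eventuallyRepeats)
    with refl ← firstRepeat-fromStart i<j walk-i≡j first
    with 3≤j@(s≤s (s≤s (s≤s _))) , 2∣j ← firstReturn-even disagree i<j walk-i≡j first
    with c , vtx≡walk ← closedWalk⇒cycle walk 3≤j walk-edge (sym walk-i≡j)
                          (λ a<b b<j walk-a≡b → first b<j (_ , a<b , walk-a≡b))
    = j , 2∣j , c , zero , vtx≡walk zero , vtx≡walk (suc zero)

alternatingCycle : ∀ {n} {G : Graph n} {S : Subset n} {f₁ f₂ : Fin n → Fin n} {v : Fin n} →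
  IsPerfectMatchingFn G S f₁ → IsPerfectMatchingFn G S f₂ → v ∈ S → f₁ v ≢ f₂ v →
  EvenCycleAlong G v (f₁ v)
alternatingCycle m₁ m₂ v∈S = AlternatingWalk.evenCycle m₁ m₂ v∈S

evenCycleAlong⇒edgeOnEvenCycle : ∀ {n} {G : Graph n} {v w} → EvenCycleAlong G v w → EdgeOnEvenCycle G v w
evenCycleAlong⇒edgeOnEvenCycle (L , 2∣L , c , a , vtx≡v , next≡w) = L , 2∣L , c , a , inj₁ (vtx≡v , next≡w)

evenCycleAlong⇒vertexOnEvenCycle : ∀ {n} {G : Graph n} {v w} → EvenCycleAlong G v w → VertexOnEvenCycle G v
evenCycleAlong⇒vertexOnEvenCycle (L , 2∣L , c , a , vtx≡v , _) = L , 2∣L , c , a , vtx≡v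

partner-unique : ∀ {n} {G : Graph n} {S f₁ f₂ v} → IsPerfectMatchingFn G S f₁ → IsPerfectMatchingFn G S f₂ →
  v ∈ S → ¬ EvenCycleAlong G v (f₁ v) → f₁ v ≡ f₂ v
partner-unique {f₁ = f₁} {f₂} {v} m₁ m₂ v∈S noCycle with f₁ v ≟ᶠ f₂ v
... | yes agree    = agree
... | no disagree = ⊥-elim (noCycle (alternatingCycle m₁ m₂ v∈S disagree))

-- The deletion formulas

record PMSet {n} (G : Graph n) (k : ℕ) (S : Subset n) : Set where
  constructor pmSet
  field
    matchable : PerfectlyMatchable G S
    size      : ∣ S ∣ ≡ 2 * k

pmSet? : ∀ {n} (G : Graph n) k → Decidable (PMSet G k)
pmSet? G k S = map′ (uncurry pmSet) (λ { (pmSet m size) → m , size })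
  (perfectlyMatchable? G S ×-dec (∣ S ∣ ≟ 2 * k))

-- The size condition reads 2 + ∣ T ∣ = 2k rather than ∣ T ∣ = 2 (k ∸ 1), so that no set qualifies for k = 0.
record PMSet⁺ {n} (G : Graph n) (k : ℕ) (T : Subset n) : Set where
  constructor pmSet⁺
  field
    matchable : PerfectlyMatchable G T
    size      : suc (suc ∣ T ∣) ≡ 2 * k

pmSet⁺? : ∀ {n} (G : Graph n) k → Decidable (PMSet⁺ G k)
pmSet⁺? G k T = map′ (uncurry pmSet⁺) (λ { (pmSet⁺ m size) → m , size })
  (perfectlyMatchable? G T ×-dec (suc (suc ∣ T ∣) ≟ 2 * k))

record MatchedPair {n} (G : Graph n) (v w : Fin n) (k : ℕ) (S : Subset n) : Set where
  constructor matchedPair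
  field
    v∈S  : v ∈ S
    w∈S  : w ∈ S
    rest : PMSet⁺ (delVertices2 G v w) k (S - v - w)

matchedPair? : ∀ {n} (G : Graph n) v w k → Decidable (MatchedPair G v w k)
matchedPair? G v w k S = map′ (λ (v∈S , w∈S , rest) → matchedPair v∈S w∈S rest)
  (λ { (matchedPair v∈S w∈S rest) → v∈S , w∈S , rest })
  (v ∈? S ×-dec w ∈? S ×-dec pmSet⁺? (delVertices2 G v w) k (S - v - w))

-- pm filters with the decision underlying pmSet?; map′ leaves does unchanged, so the sums agree.
pm≡sumSubsets : ∀ {n} (G : Graph n) k → pm G k ≡ sumSubsets (𝟙 ∘ pmSet? G k)
pm≡sumSubsets {n} G k =
  length-filter≡sum-𝟙 (λ S → perfectlyMatchable? G S ×-dec (∣ S ∣ ≟ 2 * k)) (allSubsets n)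

sumSubsets-pmSet⁺ : ∀ {n} (G : Graph n) k → sumSubsets (𝟙 ∘ pmSet⁺? G k) ≡ (z· pm G) k
sumSubsets-pmSet⁺ G zero = sumSubsets-zero λ T → 𝟙-no (pmSet⁺? G 0 T) λ { (pmSet⁺ _ ()) }
sumSubsets-pmSet⁺ G (suc k) = trans
  (sumSubsets-cong λ T → 𝟙-cong (pmSet⁺? G (suc k) T) (pmSet? G k T)
     (λ { (pmSet⁺ m size) → pmSet m (shrink size) }) (λ { (pmSet m size) → pmSet⁺ m (grow size) }))
  (sym (pm≡sumSubsets G k))
  where
  shrink : ∀ {m} → suc (suc m) ≡ 2 * suc k → m ≡ 2 * k
  shrink eq rewrite *-suc 2 k = suc-injective (suc-injective eq)
  grow : ∀ {m} → m ≡ 2 * k → suc (suc m) ≡ 2 * suc k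
  grow refl rewrite *-suc 2 k = refl

sumSubsets-matchedPair : ∀ {n} (G : Graph n) {v w} k → v ≢ w →
  sumSubsets (𝟙 ∘ matchedPair? G v w k) ≡ (z· pm (delVertices2 G v w)) k
sumSubsets-matchedPair G {v} {w} k v≢w =
  trans (sumSubsets-pair v≢w (pmSet⁺? (delVertices2 G v w) k) avoids) (sumSubsets-pmSet⁺ (delVertices2 G v w) k)
  where
  avoids : ∀ {T} → PMSet⁺ (delVertices2 G v w) k T → v ∉ T × w ∉ T
  avoids (pmSet⁺ (T⊆V , _) _) =
    (λ v∈T → x∈p-y⇒x≢y (x∈p-y⇒x∈p (T⊆V v∈T)) refl) , (λ w∈T → x∈p-y⇒x≢y (T⊆V w∈T) refl)

module _ {n} {G : Graph n} {k : ℕ} {S : Subset n} where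

  pmSet⇒matching : PMSet G k S → ∃ λ f → IsPerfectMatchingFn G S f
  pmSet⇒matching (pmSet (_ , m , isPM) _) = lookup m , fromIsPerfectMatching {G = G} {m = m} isPM

  matching⇒pmSet : ∀ {f} → IsPerfectMatchingFn G S f → ∣ S ∣ ≡ 2 * k → PMSet G k S
  matching⇒pmSet m size = pmSet (perfectlyMatchable m) size

  matchedPair⇒pmSet : ∀ {v w} → Edge G v w → MatchedPair G v w k S → PMSet G k S
  matchedPair⇒pmSet vw (matchedPair v∈S w∈S (pmSet⁺ (_ , m , isPM) size)) =
    matching⇒pmSet
      (isPerfectMatchingFn-addPair vw v∈S w∈S (fromIsPerfectMatching {G = delVertices2 G _ _} {m = m} isPM))
                   (trans (∣p∣≡2+∣p-v-w∣ v∈S w∈S (edge⇒≢ {G = G} vw)) size)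

  matching⇒matchedPair : ∀ {f v w} → IsPerfectMatchingFn G S f → v ∈ S → f v ≡ w → ∣ S ∣ ≡ 2 * k →
    MatchedPair G v w k S
  matching⇒matchedPair {f} {v} {w} m v∈S fv≡w size =
    matchedPair v∈S w∈S (pmSet⁺ (perfectlyMatchable (isPerfectMatchingFn-removePair m v∈S fv≡w))
                                 (trans (sym (∣p∣≡2+∣p-v-w∣ v∈S w∈S v≢w)) size))
    where
    w∈S : w ∈ S
    w∈S = subst (_∈ S) fv≡w (partner∈ m v∈S)
    v≢w : v ≢ w
    v≢w v≡w = partner≢ m v∈S (trans fv≡w (sym v≡w))

pmSet-mapEdges : ∀ {n} {G H : Graph n} {k S} → (∀ {i j} → Edge G i j → Edge H i j) →
  PMSet G k S → PMSet H k S
pmSet-mapEdges G⇒H S-pm with f , m ← pmSet⇒matching S-pm =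
  matching⇒pmSet (isPerfectMatchingFn-mapEdges (λ _ → G⇒H) m) (PMSet.size S-pm)

module EdgeDeletion {n} {G : Graph n} {v w : Fin n} (vw : Edge G v w) (noCycle : ¬ EdgeOnEvenCycle G v w)
                    (k : ℕ) {S : Subset n} where

  -- A matching of G \ e cannot use e, yet by uniqueness of partners it would have to match v to w.
  ¬pmSet-delEdge×matchedPair : PMSet (delEdge G v w) k S → ¬ MatchedPair G v w k S
  ¬pmSet-delEdge×matchedPair S-pm (matchedPair v∈S w∈S (pmSet⁺ (_ , m , isPM) _))
    with f , mₑ ← pmSet⇒matching S-pm =
    delEdge-removes {G = G} (subst (Edge (delEdge G v w) v) fv≡w (partner-edge mₑ v∈S))
    where
    pair : IsPerfectMatchingFn G S (matchPair v w (lookup m))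
    pair = isPerfectMatchingFn-addPair vw v∈S w∈S (fromIsPerfectMatching {G = delVertices2 G v w} {m = m} isPM)
    fv≡w : f v ≡ w
    fv≡w = trans (sym (partner-unique pair (isPerfectMatchingFn-mapEdges (λ _ → delEdge-edge⁻ {G = G}) mₑ) v∈S
             (noCycle ∘ evenCycleAlong⇒edgeOnEvenCycle ∘ subst (EvenCycleAlong G v) (matchPair-v {v = v} _))))
           (matchPair-v {v = v} _)

  pmSet⇒matchedPair : PMSet G k S → ¬ PMSet (delEdge G v w) k S → MatchedPair G v w k S
  pmSet⇒matchedPair S-pm ¬Sₑ-pm with f , m ← pmSet⇒matching S-pm with v ∈? S ×-dec f v ≟ᶠ w
  ... | yes (v∈S , fv≡w) = matching⇒matchedPair m v∈S fv≡w (PMSet.size S-pm)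
  ... | no ¬matched = ⊥-elim (¬Sₑ-pm (matching⇒pmSet (isPerfectMatchingFn-mapEdges avoid m) (PMSet.size S-pm)))
    where
    avoid : ∀ {i} → i ∈ S → Edge G i (f i) → Edge (delEdge G v w) i (f i)
    avoid i∈S edge = delEdge-edge⁺ {G = G} edge
      (λ { (refl , fv≡w) → ¬matched (i∈S , fv≡w) })
      (λ { (refl , fw≡v) → ¬matched (subst (_∈ S) fw≡v (partner∈ m i∈S) ,
                                     trans (cong f (sym fw≡v)) (partner-invol m i∈S)) })

  𝟙-pmSet-delEdge : 𝟙 (pmSet? G k S) ≡ 𝟙 (pmSet? (delEdge G v w) k S) + 𝟙 (matchedPair? G v w k S)
  𝟙-pmSet-delEdge = 𝟙-split (pmSet? G k S) (pmSet? (delEdge G v w) k S)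
    (pmSet-mapEdges (delEdge-edge⁻ {G = G}))
    (𝟙-no (matchedPair? G v w k S) ∘ ¬pmSet-delEdge×matchedPair)
    (λ S-pm ¬Sₑ-pm → 𝟙-yes (matchedPair? G v w k S) (pmSet⇒matchedPair S-pm ¬Sₑ-pm))
    (λ ¬S-pm → 𝟙-no (matchedPair? G v w k S) (¬S-pm ∘ matchedPair⇒pmSet vw))

pm-delEdge : ∀ {n} (G : Graph n) (v w : Fin n) → Edge G v w → ¬ EdgeOnEvenCycle G v w →
  ∀ k → pm G k ≡ (pm (delEdge G v w) ⊕ (z· pm (delVertices2 G v w))) k
pm-delEdge {n} G v w vw noCycle k = begin
  pm G k                                          ≡⟨ pm≡sumSubsets G k ⟩
  sumSubsets (𝟙 ∘ pmSet? G k)                     ≡⟨ sumSubsets-cong (λ S → 𝟙-pmSet-delEdge {S = S}) ⟩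
  sumSubsets (λ S → 𝟙 (pmSet? Gₑ k S) + 𝟙 (matchedPair? G v w k S))
    ≡⟨ sumSubsets-+ (𝟙 ∘ pmSet? Gₑ k) (𝟙 ∘ matchedPair? G v w k) ⟩
  sumSubsets (𝟙 ∘ pmSet? Gₑ k) + sumSubsets (𝟙 ∘ matchedPair? G v w k)
    ≡⟨ cong₂ _+_ (sym (pm≡sumSubsets Gₑ k)) (sumSubsets-matchedPair G k (edge⇒≢ {G = G} vw)) ⟩
  pm Gₑ k + (z· pm (delVertices2 G v w)) k        ∎
  where
  open ≡-Reasoning
  open EdgeDeletion vw noCycle k
  Gₑ : Graph n
  Gₑ = delEdge G v w

z·-zero : ∀ k → (z· (λ _ → 0)) k ≡ 0
z·-zero zero = refl
z·-zero (suc k) = refl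

z·-∑ : ∀ {n} (F : Fin n → Poly) k → ∑[ i < n ] (z· F i) k ≡ (z· ∑ F) k
z·-∑ {n} F zero = ∑-zero {n} λ _ → refl
z·-∑ F (suc k) = sym (sum-allFin (λ i → F i k))

neighbourPair? : ∀ {n} (G : Graph n) v k w → Decidable (λ S → Edge G v w × MatchedPair G v w k S)
neighbourPair? G v k w S = edge? G v w ×-dec matchedPair? G v w k S

sumSubsets-neighbourPair : ∀ {n} (G : Graph n) v k w (vw? : Dec (Edge G v w)) →
  sumSubsets (λ S → 𝟙 (vw? ×-dec matchedPair? G v w k S)) ≡
  (z· (if ⌊ vw? ⌋ then pm (delVertices2 G v w) else (λ _ → 0))) k
sumSubsets-neighbourPair G v k w (yes vw) = sumSubsets-matchedPair G k (edge⇒≢ {G = G} vw)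
sumSubsets-neighbourPair {n} G v k w (no _) = trans (sumSubsets-zero {n} λ _ → refl) (sym (z·-zero k))

module VertexDeletion {n} {G : Graph n} {v : Fin n} (noCycle : ¬ VertexOnEvenCycle G v)
                      (k : ℕ) {S : Subset n} where

  pmSet-delVertex⇒∉ : PMSet (delVertex G v) k S → v ∉ S
  pmSet-delVertex⇒∉ (pmSet (S⊆V , _) _) v∈S = x∈p-y⇒x≢y (S⊆V v∈S) refl

  ∉⇒pmSet-delVertex : PMSet G k S → v ∉ S → PMSet (delVertex G v) k S
  ∉⇒pmSet-delVertex S-pm v∉S with f , m ← pmSet⇒matching S-pm =
    matching⇒pmSet (isPerfectMatchingFn-mapEdges avoid m) (PMSet.size S-pm)
    where
    avoid : ∀ {i} → i ∈ S → Edge G i (f i) → Edge (delVertex G v) i (f i)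
    avoid i∈S edge = delVertex-edge⁺ {G = G} edge
      (λ { refl → v∉S i∈S }) (λ fi≡v → v∉S (subst (_∈ S) fi≡v (partner∈ m i∈S)))

  neighbourPair-unique : ∀ {f} → IsPerfectMatchingFn G S f → v ∈ S →
    ∀ {w} → Edge G v w × MatchedPair G v w k S → w ≡ f v
  neighbourPair-unique m v∈S {w} (vw , matchedPair _ w∈S (pmSet⁺ (_ , mₚ , isPM) _)) =
    trans (sym (matchPair-v {v = v} _))
          (partner-unique pair m v∈S (noCycle ∘ evenCycleAlong⇒vertexOnEvenCycle))
    where
    pair : IsPerfectMatchingFn G S (matchPair v w (lookup mₚ))
    pair = isPerfectMatchingFn-addPair vw v∈S w∈S (fromIsPerfectMatching {G = delVertices2 G v w} {m = mₚ} isPM)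

  𝟙-pmSet-delVertex :
    𝟙 (pmSet? G k S) ≡ 𝟙 (pmSet? (delVertex G v) k S) + ∑[ w < n ] 𝟙 (neighbourPair? G v k w S)
  𝟙-pmSet-delVertex = 𝟙-split (pmSet? G k S) (pmSet? (delVertex G v) k S)
    (pmSet-mapEdges (delVertex-edge⁻ {G = G}))
    (λ Sᵥ-pm → ∑-zero λ w → 𝟙-no (neighbourPair? G v k w S) λ (_ , pair) →
      pmSet-delVertex⇒∉ Sᵥ-pm (MatchedPair.v∈S pair))
    exactlyOne
    (λ ¬S-pm → ∑-zero λ w → 𝟙-no (neighbourPair? G v k w S) λ (vw , pair) →
      ¬S-pm (matchedPair⇒pmSet vw pair))
    where
    exactlyOne : PMSet G k S → ¬ PMSet (delVertex G v) k S → ∑[ w < n ] 𝟙 (neighbourPair? G v k w S) ≡ 1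
    exactlyOne S-pm ¬Sᵥ-pm with f , m ← pmSet⇒matching S-pm =
      ∑-𝟙-unique (λ w → neighbourPair? G v k w S)
        (partner-edge m v∈S , matching⇒matchedPair m v∈S refl (PMSet.size S-pm)) (neighbourPair-unique m v∈S)
      where
      v∈S : v ∈ S
      v∈S = decidable-stable (v ∈? S) (¬Sᵥ-pm ∘ ∉⇒pmSet-delVertex S-pm)

pm-delVertex : ∀ {n} (G : Graph n) (v : Fin n) → ¬ VertexOnEvenCycle G v →
  ∀ k → pm G k ≡ (pm (delVertex G v) ⊕ (z· neighbourSum G v)) k
pm-delVertex {n} G v noCycle k = begin
  pm G k                                                           ≡⟨ pm≡sumSubsets G k ⟩
  sumSubsets (𝟙 ∘ pmSet? G k)
    ≡⟨ sumSubsets-cong (λ S → 𝟙-pmSet-delVertex {S = S}) ⟩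
  sumSubsets (λ S → 𝟙 (pmSet? Gᵥ k S) + ∑[ w < n ] 𝟙 (neighbourPair? G v k w S))
    ≡⟨ sumSubsets-+ (𝟙 ∘ pmSet? Gᵥ k) _ ⟩
  sumSubsets (𝟙 ∘ pmSet? Gᵥ k) + sumSubsets (λ S → ∑[ w < n ] 𝟙 (neighbourPair? G v k w S))
    ≡⟨ cong₂ _+_ (sym (pm≡sumSubsets Gᵥ k))
                 (sum-map-∑-comm (λ w → 𝟙 ∘ neighbourPair? G v k w) (allSubsets n)) ⟩
  pm Gᵥ k + ∑[ w < n ] sumSubsets (𝟙 ∘ neighbourPair? G v k w)
    ≡⟨ cong (pm Gᵥ k +_) (sum-cong-≗ λ w → sumSubsets-neighbourPair G v k w (edge? G v w)) ⟩
  pm Gᵥ k + ∑[ w < n ] (z· F w) k                                  ≡⟨ cong (pm Gᵥ k +_) (z·-∑ F k) ⟩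
  pm Gᵥ k + (z· neighbourSum G v) k                                ∎
  where
  open ≡-Reasoning
  open VertexDeletion noCycle k
  F : Fin n → Poly
  F w = if ⌊ edge? G v w ⌋ then pm (delVertices2 G v w) else (λ _ → 0)
  Gᵥ : Graph n
  Gᵥ = delVertex G v

mainTheorem4 :
    (∀ {n} (G : Graph n) (v w : Fin n) → Edge G v w → ¬ EdgeOnEvenCycle G v w →
       ∀ k → pm G k ≡ (pm (delEdge G v w) ⊕ (z· pm (delVertices2 G v w))) k)
    ×
    (∀ {n} (G : Graph n) (v : Fin n) → v ∈ V G → ¬ VertexOnEvenCycle G v →
       ∀ k → pm G k ≡ (pm (delVertex G v) ⊕ (z· neighbourSum G v)) k)
mainTheorem4 = pm-delEdge , λ G v _ → pm-delVertex G v
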